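{- Consider an edge-to-edge tiling of the sphere by $f$ congruent quadrilaterals with all vertices of degree $\ge3$. Suppose every degree-$3$ vertex is of type $\theta^2\varphi$, where $\theta\ne\varphi$ are angles of the tile. Then: 1. $v_4=10+\sum_{h\ge5}(h-5)v_h+\#_{\ge4}\theta$. 2. $v_4\ge10+\#_{\ge4}\theta$ and $f\ge16$; in particular there is a degree-$4$ vertex. 3. There is a degree-$4$ vertex without $\theta$. 4. Let $k\ge5$. If $\varphi$ appears at no vertex of degree $i$ for every $4\le i\le k$, then there is a vertex of degree $\ge k+1$ containing at least $\lfloor k/2\rfloor+1$ copies of $\varphi$. 5. Let $\psi\ne\theta,\varphi$. If every degree-$4$ vertex is $\psi^4$, then: - there is a degree-$5$ vertex containing at most one angle from $\{\psi,\theta\}$ (counted with multiplicity); - there is a degree-$5$ vertex without $\theta$. 6. Let $\psi\ne\theta,\varphi$. If at every degree-$4$ vertex the copies of $\theta$ and $\psi$ together number four, then there is a degree-$5$ vertex containing at most one angle from $\{\theta,\psi\}$. 7. If $\varphi$ appears at least twice at every degree-$4$ vertex, then there is a degree-$5$ vertex containing neither $\varphi$ nor $\theta$. 8. For any angle $\psi\ne\theta,\varphi$, at least one of the following holds: - there is a degree-$4$ vertex containing $\psi$; - there is a degree-$5$ vertex containing at least three $\psi$; - there is a degree-$6$ vertex containing at least five $\psi$; - $\psi^7$ is a vertex.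
   Context: $v_h$ is the number of vertices of degree $h$ (the number of angles meeting there). $\#_{\ge4}\theta$ is the total number of copies of $\theta$ at vertices of degree $\ge4$. The four angles of the tile are treated as labels. $\theta^2\varphi$ is a vertex with two $\theta$ and one $\varphi$; $\psi^n$ is a vertex of $n$ copies of $\psi$. -}

module Defs where

open import Data.Nat using (ℕ; zero; suc; _+_; _*_; _≤?_)
open import Data.Fin using (Fin; zero; suc; toℕ; _≟_)
open import Data.Product using (_×_; _,_; ∃)
open import Data.Sum using (_⊎_)
open import Relation.Binary.PropositionalEquality using (_≡_; _≢_)
open import Relation.Nullary using (Dec; yes; no)

sumFin : (n : ℕ) → (Fin n → ℕ) → ℕ
sumFin zero    f = 0
sumFin (suc n) f = f zero + sumFin n (λ i → f (suc i))

ind : ∀ {p} {P : Set p} → Dec P → ℕ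
ind (yes _) = 1
ind (no  _) = 0

cyc : Fin 4 → Fin 4
cyc zero                   = suc zero
cyc (suc zero)             = suc (suc zero)
cyc (suc (suc zero))       = suc (suc (suc zero))
cyc (suc (suc (suc zero))) = zero

cyc⁻ : Fin 4 → Fin 4
cyc⁻ zero                   = suc (suc (suc zero))
cyc⁻ (suc zero)             = zero
cyc⁻ (suc (suc zero))       = suc zero
cyc⁻ (suc (suc (suc zero))) = suc (suc zero)

iter : ∀ {a} {A : Set a} → ℕ → (A → A) → A → A
iter zero    g x = x
iter (suc k) g x = g (iter k g x)

-- A dart (t , i) is corner i of tile t; it also names the side of tile t
-- going from corner i to corner (i+1).  Tiles are oriented coherently.

Dart : ℕ → Set
Dart F = Fin F × Fin 4

sumDart : (F : ℕ) → (Dart F → ℕ) → ℕ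
sumDart F g = sumFin F (λ t → sumFin 4 (λ i → g (t , i)))

-- The side (t , i) is glued to the side opp (t , i) = (t' , j) with reversed
-- orientation, so corner i of t coincides with corner (j+1) of t'.
-- Rotation around a vertex:
rotation : {F : ℕ} → (Dart F → Dart F) → Dart F → Dart F
rotation opp d with opp d
... | (t' , j) = (t' , cyc j)

faceNext : {F : ℕ} → Dart F → Dart F
faceNext (t , i) = (t , cyc i)

data Reach {F : ℕ} (opp : Dart F → Dart F) : Dart F → Dart F → Set where
  here   : ∀ {d} → Reach opp d d
  across : ∀ {d d'} → Reach opp (opp d) d' → Reach opp d d'
  along  : ∀ {d d'} → Reach opp (faceNext d) d' → Reach opp d d'

record QuadTiling : Set where
  field
    F V E  : ℕ
    opp    : Dart F → Dart F
    opp-invol : ∀ d → opp (opp d) ≡ d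
    opp-fpf   : ∀ d → opp d ≢ d
    edge      : Dart F → Fin E
    edge-surj : ∀ e → ∃ λ d → edge d ≡ e
    edge-fib  : ∀ d d' → (edge d ≡ edge d' → d' ≡ d ⊎ d' ≡ opp d)
                       × (d' ≡ d ⊎ d' ≡ opp d → edge d ≡ edge d')
    vertex      : Dart F → Fin V
    vertex-surj : ∀ v → ∃ λ d → vertex d ≡ v
    vertex-fib  : ∀ d d' → (vertex d ≡ vertex d' → ∃ λ k → iter k (rotation opp) d ≡ d')
                         × ((∃ λ k → iter k (rotation opp) d ≡ d') → vertex d ≡ vertex d')
    connected : ∀ d d' → Reach opp d d'
    -- the surface is a sphere: Euler characteristic 2
    euler : V + F ≡ E + 2
    -- congruent tiles: the angle labels (Fin 4 = the four angles of the
    -- prototile) go around every tile in the prototile's cyclic order,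
    -- in one direction or the other (the tile may be reflected)
    angle     : Dart F → Fin 4
    congruent : ∀ t → (∀ i → angle (t , cyc i) ≡ cyc (angle (t , i)))
                    ⊎ (∀ i → angle (t , cyc i) ≡ cyc⁻ (angle (t , i)))

module _ (T : QuadTiling) where
  open QuadTiling T

  deg : Fin V → ℕ
  deg v = sumDart F (λ d → ind (vertex d ≟ v))

  angCount : Fin V → Fin 4 → ℕ
  angCount v a = sumDart F (λ d → ind (vertex d ≟ v) * ind (angle d ≟ a))

  vnum : ℕ → ℕ
  vnum h = sumFin V (λ v → ind (deg v Data.Nat.≟ h))

  -- Σ_{h≥5} (h-5) v_h ; degrees are at most 4F, so h ranges over 5..4F
  excess5 : ℕ
  excess5 = sumFin (suc (4 * F)) (λ h → (toℕ h Data.Nat.∸ 5) * vnum (toℕ h))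

  countHigh : Fin 4 → ℕ
  countHigh a = sumFin V (λ v → ind (4 ≤? deg v) * angCount v a)

module Submission where

open import Defs
open import Data.Nat using (ℕ; zero; suc; _+_; _*_; _∸_; _/_; _≤_; _<_; _≤?_; z≤n; s≤s; z<s)
import Data.Nat as ℕ
open import Data.Nat.Properties hiding (suc-injective; _≟_)
open import Data.Nat.DivMod using (m<n*o⇒m/o<n)
open import Data.Nat.Tactic.RingSolver using (solve-∀)
open import Algebra.Properties.Semiring.Sum +-*-semiring
  using (sum; ∑-distrib-+; ∑-comm; *-distribˡ-sum; *-distribʳ-sum)
open import Data.Fin using (Fin; zero; suc; toℕ; fromℕ<; _≟_)
open import Data.Fin.Properties using (any?; all?; suc-injective; toℕ-fromℕ<; toℕ-injective)
open import Data.Product using (_×_; _,_; ∃; proj₁; proj₂; map₂)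
open import Data.Product.Properties using (≡-dec)
open import Data.Sum using (_⊎_; inj₁; inj₂; [_,_]′)
open import Function using (_∘_; case_of_)
open import Relation.Nullary using (¬_; Dec; yes; no; contradiction)
open import Relation.Nullary.Decidable using (from-yes; _×-dec_; _⊎-dec_)
open import Relation.Unary using (Pred; Decidable)
open import Relation.Binary.PropositionalEquality

-- Euler's formula and double counting give V = F + 2 and Σ_v deg v = 4F, and since every tile
-- carries each of its four angles exactly once, every angle a occurs F times in total.  So any
-- vertex weight built from deg, the angle counts and constants has a total that is linear in F.
-- Each claim is proved by choosing two such weights L and R with Σ R < Σ L and checking, degree
-- by degree, that L v ≤ R v at every vertex violating the claim; the degree-3 vertices are θ²φ,
-- which pins their weights down.  Part 1 is the exact count with the identity
-- [deg = 4] + deg + #θ = 5 + (deg ∸ 5) + [deg ≥ 4]·#θ at every vertex.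

ind-yes : ∀ {p} {P : Set p} (P? : Dec P) → P → ind P? ≡ 1
ind-yes (yes _) _  = refl
ind-yes (no ¬p) p = contradiction p ¬p

ind-no : ∀ {p} {P : Set p} (P? : Dec P) → ¬ P → ind P? ≡ 0
ind-no (yes p) ¬p = contradiction p ¬p
ind-no (no _)  _  = refl

sumFin≡sum : ∀ n (f : Fin n → ℕ) → sumFin n f ≡ sum f
sumFin≡sum zero    f = refl
sumFin≡sum (suc n) f = cong (f zero +_) (sumFin≡sum n (λ i → f (suc i)))

sumFin-cong : ∀ n {f g : Fin n → ℕ} → (∀ i → f i ≡ g i) → sumFin n f ≡ sumFin n g
sumFin-cong zero    f≗g = refl
sumFin-cong (suc n) f≗g = cong₂ _+_ (f≗g zero) (sumFin-cong n (λ i → f≗g (suc i)))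

sumFin-+ : ∀ n (f g : Fin n → ℕ) → sumFin n (λ i → f i + g i) ≡ sumFin n f + sumFin n g
sumFin-+ n f g = begin
  sumFin n (λ i → f i + g i) ≡⟨ sumFin≡sum n _ ⟩
  sum (λ i → f i + g i)      ≡⟨ ∑-distrib-+ f g ⟩
  sum f + sum g              ≡⟨ sym (cong₂ _+_ (sumFin≡sum n f) (sumFin≡sum n g)) ⟩
  sumFin n f + sumFin n g    ∎
  where open ≡-Reasoning

sumFin-*ˡ : ∀ n c (f : Fin n → ℕ) → sumFin n (λ i → c * f i) ≡ c * sumFin n f
sumFin-*ˡ n c f = begin
  sumFin n (λ i → c * f i) ≡⟨ sumFin≡sum n _ ⟩
  sum (λ i → c * f i)      ≡⟨ sym (*-distribˡ-sum c f) ⟩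
  c * sum f                ≡⟨ cong (c *_) (sym (sumFin≡sum n f)) ⟩
  c * sumFin n f           ∎
  where open ≡-Reasoning

sumFin-*ʳ : ∀ n c (f : Fin n → ℕ) → sumFin n (λ i → f i * c) ≡ sumFin n f * c
sumFin-*ʳ n c f = begin
  sumFin n (λ i → f i * c) ≡⟨ sumFin≡sum n _ ⟩
  sum (λ i → f i * c)      ≡⟨ sym (*-distribʳ-sum c f) ⟩
  sum f * c                ≡⟨ cong (_* c) (sym (sumFin≡sum n f)) ⟩
  sumFin n f * c           ∎
  where open ≡-Reasoning

sumFin-comm : ∀ m n (f : Fin m → Fin n → ℕ) →
              sumFin m (λ i → sumFin n (f i)) ≡ sumFin n (λ j → sumFin m (λ i → f i j))
sumFin-comm m n f = begin
  sumFin m (λ i → sumFin n (f i))           ≡⟨ sumFin-cong m (λ i → sumFin≡sum n (f i)) ⟩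
  sumFin m (λ i → sum (f i))                ≡⟨ sumFin≡sum m _ ⟩
  sum (λ i → sum (f i))                     ≡⟨ ∑-comm f ⟩
  sum (λ j → sum (λ i → f i j))             ≡⟨ sym (sumFin≡sum n _) ⟩
  sumFin n (λ j → sum (λ i → f i j))        ≡⟨ sumFin-cong n (λ j → sym (sumFin≡sum m _)) ⟩
  sumFin n (λ j → sumFin m (λ i → f i j))   ∎
  where open ≡-Reasoning

sumFin-const : ∀ n c → sumFin n (λ _ → c) ≡ n * c
sumFin-const zero    c = refl
sumFin-const (suc n) c = cong (c +_) (sumFin-const n c)

sumFin-mono : ∀ n {f g : Fin n → ℕ} → (∀ i → f i ≤ g i) → sumFin n f ≤ sumFin n g
sumFin-mono zero    f≤g = z≤n
sumFin-mono (suc n) f≤g = +-mono-≤ (f≤g zero) (sumFin-mono n (λ i → f≤g (suc i)))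

sumFin-zero : ∀ n {f : Fin n → ℕ} → (∀ i → f i ≡ 0) → sumFin n f ≡ 0
sumFin-zero n f≗0 = trans (sumFin-cong n f≗0) (trans (sumFin-const n 0) (*-zeroʳ n))

sumFin-single : ∀ n (f : Fin n → ℕ) x → (∀ i → i ≢ x → f i ≡ 0) → sumFin n f ≡ f x
sumFin-single (suc n) f zero    f≡0 =
  trans (cong (f zero +_) (sumFin-zero n (λ i → f≡0 (suc i) λ ()))) (+-identityʳ (f zero))
sumFin-single (suc n) f (suc x) f≡0 =
  cong₂ _+_ (f≡0 zero λ ()) (sumFin-single n (λ i → f (suc i)) x
    (λ i i≢x → f≡0 (suc i) (i≢x ∘ suc-injective)))

sumFin-ind-≟ : ∀ n (x : Fin n) → sumFin n (λ i → ind (x ≟ i)) ≡ 1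
sumFin-ind-≟ n x = trans (sumFin-single n _ x (λ i i≢x → ind-no (x ≟ i) (i≢x ∘ sym)))
                         (ind-yes (x ≟ x) refl)

sumFin-lookup-≤ : ∀ n (f : Fin n → ℕ) x → f x ≤ sumFin n f
sumFin-lookup-≤ (suc n) f zero    = m≤m+n (f zero) _
sumFin-lookup-≤ (suc n) f (suc x) = ≤-trans (sumFin-lookup-≤ n (λ i → f (suc i)) x) (m≤n+m _ (f zero))

ind-distinct₃ : ∀ {n} {a b c : Fin n} → a ≢ b → a ≢ c → b ≢ c →
                ∀ x → ind (x ≟ a) + ind (x ≟ b) + ind (x ≟ c) ≤ 1
ind-distinct₃ {a = a} {b} {c} a≢b a≢c b≢c x with x ≟ a | x ≟ b | x ≟ c
... | yes refl | yes refl | _        = contradiction refl a≢b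
... | yes refl | _        | yes refl = contradiction refl a≢c
... | _        | yes refl | yes refl = contradiction refl b≢c
... | yes _    | no _     | no _     = ≤-refl
... | no _     | yes _    | no _     = ≤-refl
... | no _     | no _     | yes _    = ≤-refl
... | no _     | no _     | no _     = z≤n

∃-by-counting : ∀ {n p} {P : Pred (Fin n) p} {L R : Fin n → ℕ} → Decidable P →
                (∀ i → ¬ P i → L i ≤ R i) → sumFin n R < sumFin n L → ∃ P
∃-by-counting {n} P? L≤R ΣR<ΣL with any? P?
... | yes ∃P = ∃P
... | no ¬∃P = contradiction (sumFin-mono n (λ i → L≤R i (λ Pi → ¬∃P (i , Pi)))) (<⇒≱ ΣR<ΣL)

sumFin-histogram : ∀ m n (f : Fin m → ℕ) (g : ℕ → ℕ) → (∀ i → f i < n) →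
  sumFin n (λ h → g (toℕ h) * sumFin m (λ i → ind (f i ℕ.≟ toℕ h))) ≡ sumFin m (λ i → g (f i))
sumFin-histogram m n f g f<n = begin
  sumFin n (λ h → g (toℕ h) * sumFin m (λ i → ind (f i ℕ.≟ toℕ h)))
    ≡⟨ sumFin-cong n (λ h → sym (sumFin-*ˡ m (g (toℕ h)) _)) ⟩
  sumFin n (λ h → sumFin m (λ i → g (toℕ h) * ind (f i ℕ.≟ toℕ h)))
    ≡⟨ sumFin-comm n m _ ⟩
  sumFin m (λ i → sumFin n (λ h → g (toℕ h) * ind (f i ℕ.≟ toℕ h)))
    ≡⟨ sumFin-cong m at-f ⟩
  sumFin m (λ i → g (f i)) ∎
  where
  open ≡-Reasoning
  at-f : ∀ i → sumFin n (λ h → g (toℕ h) * ind (f i ℕ.≟ toℕ h)) ≡ g (f i)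
  at-f i = begin
    sumFin n (λ h → g (toℕ h) * ind (f i ℕ.≟ toℕ h))
      ≡⟨ sumFin-single n _ x vanishes ⟩
    g (toℕ x) * ind (f i ℕ.≟ toℕ x)
      ≡⟨ cong (λ h → g h * ind (f i ℕ.≟ h)) (toℕ-fromℕ< (f<n i)) ⟩
    g (f i) * ind (f i ℕ.≟ f i)
      ≡⟨ cong (g (f i) *_) (ind-yes (f i ℕ.≟ f i) refl) ⟩
    g (f i) * 1
      ≡⟨ *-identityʳ (g (f i)) ⟩
    g (f i) ∎
    where
    x = fromℕ< (f<n i)
    vanishes : ∀ h → h ≢ x → g (toℕ h) * ind (f i ℕ.≟ toℕ h) ≡ 0
    vanishes h h≢x = trans
      (cong (g (toℕ h) *_) (ind-no (f i ℕ.≟ toℕ h)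
        (λ fi≡h → h≢x (toℕ-injective (trans (sym fi≡h) (sym (toℕ-fromℕ< (f<n i))))))))
      (*-zeroʳ (g (toℕ h)))

sumDart-cong : ∀ F {f g : Dart F → ℕ} → (∀ d → f d ≡ g d) → sumDart F f ≡ sumDart F g
sumDart-cong F f≗g = sumFin-cong F (λ t → sumFin-cong 4 (λ i → f≗g (t , i)))

sumDart-+ : ∀ F (f g : Dart F → ℕ) → sumDart F (λ d → f d + g d) ≡ sumDart F f + sumDart F g
sumDart-+ F f g = trans (sumFin-cong F (λ t → sumFin-+ 4 (λ i → f (t , i)) (λ i → g (t , i))))
                        (sumFin-+ F _ _)

sumDart-mono : ∀ F {f g : Dart F → ℕ} → (∀ d → f d ≤ g d) → sumDart F f ≤ sumDart F g
sumDart-mono F f≤g = sumFin-mono F (λ t → sumFin-mono 4 (λ i → f≤g (t , i)))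

_≟ᴰ_ : ∀ {F} (x y : Dart F) → Dec (x ≡ y)
_≟ᴰ_ = ≡-dec _≟_ _≟_

sumDart-ind-≟ : ∀ F (x : Dart F) → sumDart F (λ d → ind (x ≟ᴰ d)) ≡ 1
sumDart-ind-≟ F x@(t₀ , i₀) =
  trans (sumFin-single F _ t₀ (λ t t≢t₀ → sumFin-zero 4 (λ i → vanishes {t , i} (t≢t₀ ∘ cong proj₁))))
        (trans (sumFin-single 4 _ i₀ (λ i i≢i₀ → vanishes {t₀ , i} (i≢i₀ ∘ cong proj₂)))
               (ind-yes (x ≟ᴰ x) refl))
  where
  vanishes : ∀ {d} → d ≢ x → ind (x ≟ᴰ d) ≡ 0
  vanishes d≢x = ind-no (_ ≟ᴰ _) (d≢x ∘ sym)

sumDart-fibres : ∀ {n} F (f : Dart F → Fin n) (g : Dart F → ℕ) →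
                 sumFin n (λ v → sumDart F (λ d → ind (f d ≟ v) * g d)) ≡ sumDart F g
sumDart-fibres {n} F f g = begin
  sumFin n (λ v → sumFin F (λ t → sumFin 4 (λ i → h v (t , i))))
    ≡⟨ sumFin-comm n F (λ v t → sumFin 4 (λ i → h v (t , i))) ⟩
  sumFin F (λ t → sumFin n (λ v → sumFin 4 (λ i → h v (t , i))))
    ≡⟨ sumFin-cong F (λ t → sumFin-comm n 4 (λ v i → h v (t , i))) ⟩
  sumDart F (λ d → sumFin n (λ v → h v d))
    ≡⟨ sumDart-cong F fibre ⟩
  sumDart F g ∎
  where
  open ≡-Reasoning
  h : Fin n → Dart F → ℕ
  h v d = ind (f d ≟ v) * g d
  fibre : ∀ d → sumFin n (λ v → h v d) ≡ g d
  fibre d = trans (sumFin-*ʳ n (g d) _)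
                  (trans (cong (_* g d) (sumFin-ind-≟ n (f d))) (*-identityˡ (g d)))

sumDart-fibre-sizes : ∀ {n} F (f : Dart F → Fin n) →
                      sumFin n (λ v → sumDart F (λ d → ind (f d ≟ v))) ≡ F * 4
sumDart-fibre-sizes {n} F f =
  trans (sumFin-cong n (λ v → sumDart-cong F (λ d → sym (*-identityʳ (ind (f d ≟ v))))))
        (trans (sumDart-fibres F f (λ _ → 1)) (sumFin-const F 4))

cyc-orbit-once : ∀ x a → sumFin 4 (λ i → ind (iter (toℕ i) cyc x ≟ a)) ≡ 1
cyc-orbit-once = from-yes (all? λ x → all? λ a → sumFin 4 (λ i → ind (iter (toℕ i) cyc x ≟ a)) ℕ.≟ 1)

cyc⁻-orbit-once : ∀ x a → sumFin 4 (λ i → ind (iter (toℕ i) cyc⁻ x ≟ a)) ≡ 1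
cyc⁻-orbit-once = from-yes (all? λ x → all? λ a → sumFin 4 (λ i → ind (iter (toℕ i) cyc⁻ x ≟ a)) ℕ.≟ 1)

cyc-step⇒iter : ∀ {A : Set} (α : Fin 4 → A) (ρ : A → A) → (∀ i → α (cyc i) ≡ ρ (α i)) →
                ∀ i → α i ≡ iter (toℕ i) ρ (α zero)
cyc-step⇒iter α ρ step zero                   = refl
cyc-step⇒iter α ρ step (suc zero)             = step zero
cyc-step⇒iter α ρ step (suc (suc zero))       = trans (step (suc zero)) (cong ρ (step zero))
cyc-step⇒iter α ρ step (suc (suc (suc zero))) =
  trans (step (suc (suc zero))) (cong ρ (trans (step (suc zero)) (cong ρ (step zero))))

module Tiling (T : QuadTiling) where
  open QuadTiling T

  tile-angle-once : ∀ t a → sumFin 4 (λ i → ind (angle (t , i) ≟ a)) ≡ 1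
  tile-angle-once t a = [ via cyc cyc-orbit-once , via cyc⁻ cyc⁻-orbit-once ]′ (congruent t)
    where
    via : ∀ ρ → (∀ x b → sumFin 4 (λ i → ind (iter (toℕ i) ρ x ≟ b)) ≡ 1) →
          (∀ i → angle (t , cyc i) ≡ ρ (angle (t , i))) →
          sumFin 4 (λ i → ind (angle (t , i) ≟ a)) ≡ 1
    via ρ orbit step = trans
      (sumFin-cong 4 (λ i → cong (λ x → ind (x ≟ a)) (cyc-step⇒iter (λ i → angle (t , i)) ρ step i)))
      (orbit (angle (t , zero)) a)

  degree-sum : sumFin V (deg T) ≡ F * 4
  degree-sum = sumDart-fibre-sizes F vertex

  angle-sum : ∀ a → sumFin V (λ v → angCount T v a) ≡ F
  angle-sum a = begin
    sumFin V (λ v → angCount T v a)         ≡⟨ sumDart-fibres F vertex (λ d → ind (angle d ≟ a)) ⟩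
    sumDart F (λ d → ind (angle d ≟ a))     ≡⟨ sumFin-cong F (λ t → tile-angle-once t a) ⟩
    sumFin F (λ _ → 1)                      ≡⟨ sumFin-const F 1 ⟩
    F * 1                                   ≡⟨ *-identityʳ F ⟩
    F                                       ∎
    where open ≡-Reasoning

  edge-darts : ∀ e → sumDart F (λ d → ind (edge d ≟ e)) ≡ 2
  edge-darts e with edge-surj e
  ... | d₀ , refl = begin
    sumDart F (λ d → ind (edge d ≟ edge d₀))
      ≡⟨ sumDart-cong F endpoint ⟩
    sumDart F (λ d → ind (d₀ ≟ᴰ d) + ind (opp d₀ ≟ᴰ d))
      ≡⟨ sumDart-+ F (λ d → ind (d₀ ≟ᴰ d)) (λ d → ind (opp d₀ ≟ᴰ d)) ⟩
    sumDart F (λ d → ind (d₀ ≟ᴰ d)) + sumDart F (λ d → ind (opp d₀ ≟ᴰ d))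
      ≡⟨ cong₂ _+_ (sumDart-ind-≟ F d₀) (sumDart-ind-≟ F (opp d₀)) ⟩
    2 ∎
    where
    open ≡-Reasoning
    endpoint : ∀ d → ind (edge d ≟ edge d₀) ≡ ind (d₀ ≟ᴰ d) + ind (opp d₀ ≟ᴰ d)
    endpoint d with d₀ ≟ᴰ d | opp d₀ ≟ᴰ d
    ... | yes refl | yes d≡opp = contradiction d≡opp (opp-fpf d)
    ... | yes refl | no _  = ind-yes (edge d ≟ edge d) refl
    ... | no _ | yes refl  = ind-yes (_ ≟ _) (sym (proj₂ (edge-fib d₀ (opp d₀)) (inj₂ refl)))
    ... | no d≢d₀ | no d≢opp = ind-no (_ ≟ _)
      (λ same → [ d≢d₀ ∘ sym , d≢opp ∘ sym ]′ (proj₁ (edge-fib d₀ d) (sym same)))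

  edge-count : E * 2 ≡ F * 4
  edge-count = begin
    E * 2                                                   ≡⟨ sumFin-const E 2 ⟨
    sumFin E (λ _ → 2)                                      ≡⟨ sumFin-cong E edge-darts ⟨
    sumFin E (λ e → sumDart F (λ d → ind (edge d ≟ e)))     ≡⟨ sumDart-fibre-sizes F edge ⟩
    F * 4                                                   ∎
    where open ≡-Reasoning

  vertex-count : V ≡ F + 2
  vertex-count = +-cancelʳ-≡ F V (F + 2) (begin
    V + F          ≡⟨ euler ⟩
    E + 2          ≡⟨ cong (_+ 2) (*-cancelʳ-≡ E (F * 2) 2 (trans edge-count (sym (*-assoc F 2 2)))) ⟩
    F * 2 + 2      ≡⟨ rearrange F ⟩
    F + 2 + F      ∎)
    where
    open ≡-Reasoning
    rearrange : ∀ n → n * 2 + 2 ≡ n + 2 + n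
    rearrange = solve-∀

  degree-<-4F+1 : ∀ v → deg T v < suc (4 * F)
  degree-<-4F+1 v =
    s≤s (subst (deg T v ≤_) (trans degree-sum (*-comm F 4)) (sumFin-lookup-≤ V (deg T) v))

  excess5-≡ : excess5 T ≡ sumFin V (λ v → deg T v ∸ 5)
  excess5-≡ = sumFin-histogram V (suc (4 * F)) (deg T) (_∸ 5) degree-<-4F+1

  angCount-distinct₃ : ∀ v {a b c} → a ≢ b → a ≢ c → b ≢ c →
                       angCount T v a + angCount T v b + angCount T v c ≤ deg T v
  angCount-distinct₃ v {a} {b} {c} a≢b a≢c b≢c = begin
    angCount T v a + angCount T v b + angCount T v c
      ≡⟨ cong (_+ angCount T v c) (sumDart-+ F (at a) (at b)) ⟨
    sumDart F (λ d → at a d + at b d) + angCount T v c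
      ≡⟨ sumDart-+ F (λ d → at a d + at b d) (at c) ⟨
    sumDart F (λ d → at a d + at b d + at c d)
      ≤⟨ sumDart-mono F at-most-one ⟩
    deg T v ∎
    where
    open ≤-Reasoning
    at : Fin 4 → Dart F → ℕ
    at x d = ind (vertex d ≟ v) * ind (angle d ≟ x)
    at-most-one : ∀ d → at a d + at b d + at c d ≤ ind (vertex d ≟ v)
    at-most-one d = begin
      at a d + at b d + at c d
        ≡⟨ factor (ind (vertex d ≟ v)) (ind (angle d ≟ a)) (ind (angle d ≟ b)) (ind (angle d ≟ c)) ⟩
      ind (vertex d ≟ v) * (ind (angle d ≟ a) + ind (angle d ≟ b) + ind (angle d ≟ c))
        ≤⟨ *-monoʳ-≤ (ind (vertex d ≟ v)) (ind-distinct₃ a≢b a≢c b≢c (angle d)) ⟩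
      ind (vertex d ≟ v) * 1
        ≡⟨ *-identityʳ _ ⟩
      ind (vertex d ≟ v) ∎
      where
      factor : ∀ i x y z → i * x + i * y + i * z ≡ i * (x + y + z)
      factor = solve-∀

data Degree≥3 : ℕ → Set where
  deg3  : Degree≥3 3
  deg4+ : ∀ e → Degree≥3 (4 + e)

degree≥3 : ∀ {d} → 3 ≤ d → Degree≥3 d
degree≥3 (s≤s (s≤s (s≤s (z≤n {zero}))))  = deg3
degree≥3 (s≤s (s≤s (s≤s (z≤n {suc e})))) = deg4+ e

v₄-summand-identity : ∀ {d t} → Degree≥3 d → (d ≡ 3 → t ≡ 2) →
                      ind (d ℕ.≟ 4) + d + t ≡ 5 + (d ∸ 5) + ind (4 ≤? d) * t
v₄-summand-identity         deg3              t≡2 = cong (3 +_) (t≡2 refl)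
v₄-summand-identity {t = t} (deg4+ zero)      _   = cong (5 +_) (sym (+-identityʳ t))
v₄-summand-identity {t = t} (deg4+ (suc e))   _   = cong ((5 + e) +_) (sym (+-identityʳ t))

8≤2*d+x : ∀ {d x} → Degree≥3 d → (d ≡ 3 → 2 ≤ x) → 8 ≤ 2 * d + x
8≤2*d+x         deg3      x≥2 = +-monoʳ-≤ 6 (x≥2 refl)
8≤2*d+x {x = x} (deg4+ e) _   = ≤-trans (*-monoʳ-≤ 2 (m≤m+n 4 e)) (m≤m+n _ x)

5≤d+x : ∀ {d x} → Degree≥3 d → (d ≡ 3 → 2 ≤ x) → (d ≡ 4 → 1 ≤ x) → 5 ≤ d + x
5≤d+x         deg3            x≥2 _   = +-monoʳ-≤ 3 (x≥2 refl)
5≤d+x         (deg4+ zero)    _   x≥1 = +-monoʳ-≤ 4 (x≥1 refl)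
5≤d+x {x = x} (deg4+ (suc e)) _   _   = ≤-trans (m≤m+n 5 e) (m≤m+n _ x)

6≤d+x : ∀ {d x} → Degree≥3 d → (d ≡ 3 → 3 ≤ x) → (d ≡ 4 → 2 ≤ x) → (d ≡ 5 → 1 ≤ x) →
        6 ≤ d + x
6≤d+x         deg3                  x≥3 _   _   = +-monoʳ-≤ 3 (x≥3 refl)
6≤d+x         (deg4+ zero)          _   x≥2 _   = +-monoʳ-≤ 4 (x≥2 refl)
6≤d+x         (deg4+ (suc zero))    _   _   x≥1 = +-monoʳ-≤ 5 (x≥1 refl)
6≤d+x {x = x} (deg4+ (suc (suc e))) _   _   _   = ≤-trans (m≤m+n 6 e) (m≤m+n _ x)

12≤2*d+x : ∀ {d x} → Degree≥3 d → (d ≡ 3 → 6 ≤ x) → (d ≡ 4 → 4 ≤ x) → (d ≡ 5 → 2 ≤ x) →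
           12 ≤ 2 * d + x
12≤2*d+x         deg3                  x≥6 _   _   = +-monoʳ-≤ 6 (x≥6 refl)
12≤2*d+x         (deg4+ zero)          _   x≥4 _   = +-monoʳ-≤ 8 (x≥4 refl)
12≤2*d+x         (deg4+ (suc zero))    _   _   x≥2 = +-monoʳ-≤ 10 (x≥2 refl)
12≤2*d+x {x = x} (deg4+ (suc (suc e))) _   _   _   =
  ≤-trans (*-monoʳ-≤ 2 (m≤m+n 6 e)) (m≤m+n _ x)

[k/2]+3≤k : ∀ {k} → 5 ≤ k → k / 2 + 3 ≤ k
[k/2]+3≤k {k} (s≤s (s≤s (s≤s (s≤s (s≤s {n = j} _))))) = begin
  k / 2 + 3       ≡⟨ +-suc (k / 2) 2 ⟩
  suc (k / 2) + 2 ≤⟨ +-monoˡ-≤ 2 (m<n*o⇒m/o<n {k} {3 + j} {2} k<[3+j]*2) ⟩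
  3 + j + 2       ≡⟨ +-comm (3 + j) 2 ⟩
  k               ∎
  where
  open ≤-Reasoning
  k<[3+j]*2 : k < (3 + j) * 2
  k<[3+j]*2 = s≤s (s≤s (s≤s (s≤s (s≤s (s≤s (m≤m*n j 2))))))

p+4≤d+t : ∀ k {d t p} → 5 ≤ k → Degree≥3 d → (d ≡ 3 → t ≡ 2 × p ≡ 1) →
          (4 ≤ d → d ≤ k → p ≡ 0) → (k + 1 ≤ d → p ≤ k / 2) → p + 4 ≤ d + t
p+4≤d+t k k≥5 deg3 deg3-angles _ _ with refl , refl ← deg3-angles refl = ≤-refl
p+4≤d+t k {d} {t} {p} k≥5 (deg4+ e) _ low high with d ≤? k
... | yes d≤k rewrite low (m≤m+n 4 e) d≤k = m≤m+n 4 (e + t)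
... | no  d≰k = begin
  p + 4           ≤⟨ +-monoˡ-≤ 4 (high k+1≤d) ⟩
  k / 2 + 4       ≡⟨ +-assoc (k / 2) 3 1 ⟨
  k / 2 + 3 + 1   ≤⟨ +-monoˡ-≤ 1 ([k/2]+3≤k k≥5) ⟩
  k + 1           ≤⟨ k+1≤d ⟩
  d               ≤⟨ m≤m+n d t ⟩
  d + t           ∎
  where
  open ≤-Reasoning
  k+1≤d : k + 1 ≤ d
  k+1≤d = subst (_≤ d) (+-comm 1 k) (≰⇒> d≰k)

s+8≤2*d+t : ∀ {d t p s} → Degree≥3 d → t + p + s ≤ d → (d ≡ 3 → t ≡ 2 × p ≡ 1) →
            (d ≡ 4 → s < 1) → (d ≡ 5 → s < 3) → (d ≡ 6 → s < 5) → (d ≡ 7 → s ≢ 7) →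
            s + 8 ≤ 2 * d + t
s+8≤2*d+t {s = s} deg3 t+p+s≤3 deg3-angles _ _ _ _ with refl , refl ← deg3-angles refl =
  +-monoˡ-≤ 8 (+-cancelˡ-≤ 3 s 0 t+p+s≤3)
s+8≤2*d+t {t = t} (deg4+ zero) _ _ s<1 _ _ _ =
  ≤-trans (+-monoˡ-≤ 8 (m<1+n⇒m≤n (s<1 refl))) (m≤m+n 8 t)
s+8≤2*d+t {t = t} (deg4+ (suc zero)) _ _ _ s<3 _ _ =
  ≤-trans (+-monoˡ-≤ 8 (m<1+n⇒m≤n (s<3 refl))) (m≤m+n 10 t)
s+8≤2*d+t {t = t} (deg4+ (suc (suc zero))) _ _ _ _ s<5 _ =
  ≤-trans (+-monoˡ-≤ 8 (m<1+n⇒m≤n (s<5 refl))) (m≤m+n 12 t)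
s+8≤2*d+t {t = t} {p} {s} (deg4+ (suc (suc (suc zero)))) t+p+s≤7 _ _ _ _ s≢7 =
  ≤-trans (+-monoˡ-≤ 8 (m<1+n⇒m≤n (≤∧≢⇒< (≤-trans (m≤n+m s (t + p)) t+p+s≤7) (s≢7 refl))))
          (m≤m+n 14 t)
s+8≤2*d+t {d} {t} {p} {s} (deg4+ (suc (suc (suc (suc e))))) t+p+s≤d _ _ _ _ _ = begin
  s + 8         ≤⟨ +-monoˡ-≤ 8 (≤-trans (m≤n+m s (t + p)) t+p+s≤d) ⟩
  d + 8         ≤⟨ +-monoʳ-≤ d (m≤m+n 8 (e + 0)) ⟩
  2 * d         ≤⟨ m≤m+n (2 * d) t ⟩
  2 * d + t     ∎
  where open ≤-Reasoning

module Discharging (T : QuadTiling) (θ φ : Fin 4) (θ≢φ : θ ≢ φ)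
                   (deg≥3 : ∀ v → 3 ≤ deg T v)
                   (θ²φ : ∀ v → deg T v ≡ 3 → angCount T v θ ≡ 2 × angCount T v φ ≡ 1) where
  open QuadTiling T
  open Tiling T

  view : ∀ v → Degree≥3 (deg T v)
  view v = degree≥3 (deg≥3 v)

  θ≥2-at-3 : ∀ v → deg T v ≡ 3 → 2 ≤ angCount T v θ
  θ≥2-at-3 v d≡3 = ≤-reflexive (sym (proj₁ (θ²φ v d≡3)))

  total-+ : ∀ {f g : Fin V → ℕ} {a b} → sumFin V f ≡ a → sumFin V g ≡ b →
            sumFin V (λ v → f v + g v) ≡ a + b
  total-+ Σf Σg = trans (sumFin-+ V _ _) (cong₂ _+_ Σf Σg)

  total-* : ∀ k {f : Fin V → ℕ} {a} → sumFin V f ≡ a → sumFin V (λ v → k * f v) ≡ k * a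
  total-* k Σf = trans (sumFin-*ˡ V k _) (cong (k *_) Σf)

  total-const : ∀ c → sumFin V (λ _ → c) ≡ (F + 2) * c
  total-const c = trans (sumFin-const V c) (cong (_* c) vertex-count)

  exceeds : ∀ {L R : Fin V → ℕ} {a} k → sumFin V R ≡ a → sumFin V L ≡ a + suc k →
            sumFin V R < sumFin V L
  exceeds {a = a} k ΣR ΣL = subst₂ _<_ (sym ΣR) (sym ΣL) (m<m+n a z<s)

  v₄-formula : vnum T 4 ≡ 10 + excess5 T + countHigh T θ
  v₄-formula = +-cancelʳ-≡ (F * 5) _ _ (begin
    vnum T 4 + F * 5
      ≡⟨ split (vnum T 4) F ⟩
    vnum T 4 + F * 4 + F
      ≡⟨ total-+ (total-+ refl degree-sum) (angle-sum θ) ⟨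
    sumFin V (λ v → ind (deg T v ℕ.≟ 4) + deg T v + angCount T v θ)
      ≡⟨ sumFin-cong V (λ v → v₄-summand-identity (view v) (proj₁ ∘ θ²φ v)) ⟩
    sumFin V (λ v → 5 + (deg T v ∸ 5) + ind (4 ≤? deg T v) * angCount T v θ)
      ≡⟨ total-+ (total-+ (total-const 5) (sym excess5-≡)) refl ⟩
    (F + 2) * 5 + excess5 T + countHigh T θ
      ≡⟨ shift F (excess5 T) (countHigh T θ) ⟩
    10 + excess5 T + countHigh T θ + F * 5 ∎)
    where
    open ≡-Reasoning
    split : ∀ a n → a + n * 5 ≡ a + n * 4 + n
    split = solve-∀
    shift : ∀ n x y → (n + 2) * 5 + x + y ≡ 10 + x + y + n * 5
    shift = solve-∀

  16≤F : 16 ≤ F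
  16≤F = +-cancelˡ-≤ (F * 8) 16 F (begin
    F * 8 + 16                                       ≡⟨ arith F ⟩
    (F + 2) * 8                                      ≡⟨ total-const 8 ⟨
    sumFin V (λ _ → 8)                               ≤⟨ sumFin-mono V (λ v → 8≤2*d+x (view v) (θ≥2-at-3 v)) ⟩
    sumFin V (λ v → 2 * deg T v + angCount T v θ)    ≡⟨ total-+ (total-* 2 degree-sum) (angle-sum θ) ⟩
    2 * (F * 4) + F                                  ≡⟨ regroup F ⟩
    F * 8 + F                                        ∎)
    where
    open ≤-Reasoning
    arith : ∀ n → n * 8 + 16 ≡ (n + 2) * 8
    arith = solve-∀
    regroup : ∀ n → 2 * (n * 4) + n ≡ n * 8 + n
    regroup = solve-∀

  degree-4-without-θ : ∃ λ v → deg T v ≡ 4 × angCount T v θ ≡ 0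
  degree-4-without-θ = ∃-by-counting (λ v → deg T v ℕ.≟ 4 ×-dec angCount T v θ ℕ.≟ 0)
    (λ v ¬P → 5≤d+x (view v) (θ≥2-at-3 v) (λ d≡4 → n≢0⇒n>0 (¬P ∘ (d≡4 ,_))))
    (exceeds 9 (total-+ degree-sum (angle-sum θ)) (trans (total-const 5) (arith F)))
    where
    arith : ∀ n → (n + 2) * 5 ≡ n * 4 + n + 10
    arith = solve-∀

  φ-heavy-vertex : ∀ k → 5 ≤ k → (∀ v → 4 ≤ deg T v → deg T v ≤ k → angCount T v φ ≡ 0) →
                   ∃ λ v → k + 1 ≤ deg T v × k / 2 + 1 ≤ angCount T v φ
  φ-heavy-vertex k k≥5 φ-absent = ∃-by-counting
    (λ v → k + 1 ≤? deg T v ×-dec k / 2 + 1 ≤? angCount T v φ)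
    (λ v ¬P → p+4≤d+t k k≥5 (view v) (θ²φ v) (φ-absent v) (λ k+1≤d →
       m<1+n⇒m≤n (subst (angCount T v φ <_) (+-comm (k / 2) 1) (≰⇒> (¬P ∘ (k+1≤d ,_))))))
    (exceeds 7 (total-+ degree-sum (angle-sum θ)) (trans (total-+ (angle-sum φ) (total-const 4)) (arith F)))
    where
    arith : ∀ n → n + (n + 2) * 4 ≡ n * 4 + n + 8
    arith = solve-∀

  ∃-by-ψ+3θ-counting : ∀ ψ {p} {P : Pred (Fin V) p} → Decidable P →
    (∀ v → deg T v ≡ 4 → 4 ≤ angCount T v ψ + 3 * angCount T v θ) →
    (∀ v → deg T v ≡ 5 → ¬ P v → 2 ≤ angCount T v ψ + 3 * angCount T v θ) → ∃ P
  ∃-by-ψ+3θ-counting ψ P? at-4 at-5 = ∃-by-counting P?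
    (λ v ¬P → 12≤2*d+x (view v) (at-3 v) (at-4 v) (λ d≡5 → at-5 v d≡5 ¬P))
    (exceeds 23 (total-+ (total-* 2 degree-sum) (total-+ (angle-sum ψ) (total-* 3 (angle-sum θ))))
                (trans (total-const 12) (arith F)))
    where
    at-3 : ∀ v → deg T v ≡ 3 → 6 ≤ angCount T v ψ + 3 * angCount T v θ
    at-3 v d≡3 = subst (λ t → 6 ≤ angCount T v ψ + 3 * t) (sym (proj₁ (θ²φ v d≡3)))
                       (m≤n+m 6 (angCount T v ψ))
    arith : ∀ n → (n + 2) * 12 ≡ 2 * (n * 4) + (n + 3 * n) + 24
    arith = solve-∀

  ψ⁴⇒degree-5-vertices : ∀ ψ → (∀ v → deg T v ≡ 4 → angCount T v ψ ≡ 4) →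
            (∃ λ v → deg T v ≡ 5 × angCount T v ψ + angCount T v θ ≤ 1)
          × (∃ λ v → deg T v ≡ 5 × angCount T v θ ≡ 0)
  ψ⁴⇒degree-5-vertices ψ ψ⁴ =
    ∃-by-ψ+3θ-counting ψ (λ v → deg T v ℕ.≟ 5 ×-dec angCount T v ψ + angCount T v θ ≤? 1) at-4
      (λ v d≡5 ¬P → ≤-trans (≰⇒> (¬P ∘ (d≡5 ,_))) (+-monoʳ-≤ (angCount T v ψ) (m≤n*m _ 3))) ,
    ∃-by-ψ+3θ-counting ψ (λ v → deg T v ℕ.≟ 5 ×-dec angCount T v θ ℕ.≟ 0) at-4
      (λ v d≡5 ¬P → ≤-trans (n≤1+n 2) (≤-trans (*-monoʳ-≤ 3 (n≢0⇒n>0 (¬P ∘ (d≡5 ,_))))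
                                                (m≤n+m _ (angCount T v ψ))))
    where
    at-4 : ∀ v → deg T v ≡ 4 → 4 ≤ angCount T v ψ + 3 * angCount T v θ
    at-4 v d≡4 = subst (λ s → 4 ≤ s + 3 * angCount T v θ) (sym (ψ⁴ v d≡4)) (m≤m+n 4 _)

  θψ⁴⇒degree-5-vertex : ∀ ψ → (∀ v → deg T v ≡ 4 → angCount T v θ + angCount T v ψ ≡ 4) →
            ∃ λ v → deg T v ≡ 5 × angCount T v θ + angCount T v ψ ≤ 1
  θψ⁴⇒degree-5-vertex ψ θψ⁴ =
    ∃-by-ψ+3θ-counting ψ (λ v → deg T v ℕ.≟ 5 ×-dec angCount T v θ + angCount T v ψ ≤? 1)
      (λ v d≡4 → subst (_≤ angCount T v ψ + 3 * angCount T v θ) (θψ⁴ v d≡4) (θ+ψ≤ψ+3θ v))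
      (λ v d≡5 ¬P → ≤-trans (≰⇒> (¬P ∘ (d≡5 ,_))) (θ+ψ≤ψ+3θ v))
    where
    θ+ψ≤ψ+3θ : ∀ v → angCount T v θ + angCount T v ψ ≤ angCount T v ψ + 3 * angCount T v θ
    θ+ψ≤ψ+3θ v = ≤-trans (≤-reflexive (+-comm (angCount T v θ) (angCount T v ψ)))
                         (+-monoʳ-≤ (angCount T v ψ) (m≤n*m (angCount T v θ) 3))

  degree-5-without-θφ : (∀ v → deg T v ≡ 4 → 2 ≤ angCount T v φ) →
                        ∃ λ v → deg T v ≡ 5 × angCount T v φ ≡ 0 × angCount T v θ ≡ 0
  degree-5-without-θφ φ≥2 = ∃-by-counting
    (λ v → deg T v ℕ.≟ 5 ×-dec angCount T v φ ℕ.≟ 0 ×-dec angCount T v θ ℕ.≟ 0)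
    (λ v ¬P → 6≤d+x (view v) (at-3 v) (λ d≡4 → ≤-trans (φ≥2 v d≡4) (m≤n+m _ _))
       (λ d≡5 → n≢0⇒n>0 (λ θ+φ≡0 →
          ¬P (d≡5 , m+n≡0⇒n≡0 (angCount T v θ) θ+φ≡0 , m+n≡0⇒m≡0 (angCount T v θ) θ+φ≡0))))
    (exceeds 11 (total-+ degree-sum (total-+ (angle-sum θ) (angle-sum φ))) (trans (total-const 6) (arith F)))
    where
    at-3 : ∀ v → deg T v ≡ 3 → 3 ≤ angCount T v θ + angCount T v φ
    at-3 v d≡3 with θ²φ v d≡3
    ... | θ≡2 , φ≡1 = ≤-reflexive (sym (cong₂ _+_ θ≡2 φ≡1))
    arith : ∀ n → (n + 2) * 6 ≡ n * 4 + (n + n) + 12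
    arith = solve-∀

  ψ-rich-vertex : ∀ ψ → ψ ≢ θ → ψ ≢ φ →
      (∃ λ v → deg T v ≡ 4 × 1 ≤ angCount T v ψ)
    ⊎ (∃ λ v → deg T v ≡ 5 × 3 ≤ angCount T v ψ)
    ⊎ (∃ λ v → deg T v ≡ 6 × 5 ≤ angCount T v ψ)
    ⊎ (∃ λ v → deg T v ≡ 7 × angCount T v ψ ≡ 7)
  ψ-rich-vertex ψ ψ≢θ ψ≢φ = case ∃-by-counting {P = ψ-rich} P? bound
      (exceeds 15 (total-+ (total-* 2 degree-sum) (angle-sum θ))
                  (trans (total-+ (angle-sum ψ) (total-const 8)) (arith F))) of λ where
      (v , inj₁ p)               → inj₁ (v , p)
      (v , inj₂ (inj₁ p))        → inj₂ (inj₁ (v , p))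
      (v , inj₂ (inj₂ (inj₁ p))) → inj₂ (inj₂ (inj₁ (v , p)))
      (v , inj₂ (inj₂ (inj₂ p))) → inj₂ (inj₂ (inj₂ (v , p)))
    where
    ψ-rich : Fin V → Set
    ψ-rich v = (deg T v ≡ 4 × 1 ≤ angCount T v ψ) ⊎ (deg T v ≡ 5 × 3 ≤ angCount T v ψ)
             ⊎ (deg T v ≡ 6 × 5 ≤ angCount T v ψ) ⊎ (deg T v ≡ 7 × angCount T v ψ ≡ 7)
    P? : Decidable ψ-rich
    P? v = (deg T v ℕ.≟ 4 ×-dec 1 ≤? angCount T v ψ) ⊎-dec (deg T v ℕ.≟ 5 ×-dec 3 ≤? angCount T v ψ)
         ⊎-dec (deg T v ℕ.≟ 6 ×-dec 5 ≤? angCount T v ψ) ⊎-dec (deg T v ℕ.≟ 7 ×-dec angCount T v ψ ℕ.≟ 7)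
    bound : ∀ v → ¬ ψ-rich v → angCount T v ψ + 8 ≤ 2 * deg T v + angCount T v θ
    bound v ¬P = s+8≤2*d+t (view v) (angCount-distinct₃ v θ≢φ (ψ≢θ ∘ sym) (ψ≢φ ∘ sym)) (θ²φ v)
      (λ d≡4 → ≰⇒> (¬P ∘ inj₁ ∘ (d≡4 ,_)))
      (λ d≡5 → ≰⇒> (¬P ∘ inj₂ ∘ inj₁ ∘ (d≡5 ,_)))
      (λ d≡6 → ≰⇒> (¬P ∘ inj₂ ∘ inj₂ ∘ inj₁ ∘ (d≡6 ,_)))
      (λ d≡7 → ¬P ∘ inj₂ ∘ inj₂ ∘ inj₂ ∘ (d≡7 ,_))
    arith : ∀ n → n + (n + 2) * 8 ≡ 2 * (n * 4) + n + 16
    arith = solve-∀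

lemma7 : (T : QuadTiling) (θ φ : Fin 4) → θ ≢ φ
    → (∀ v → 3 ≤ deg T v)
    → (∀ v → deg T v ≡ 3 → angCount T v θ ≡ 2 × angCount T v φ ≡ 1)
    → (vnum T 4 ≡ 10 + excess5 T + countHigh T θ)
    × ((10 + countHigh T θ ≤ vnum T 4) × (16 ≤ QuadTiling.F T) × (∃ λ v → deg T v ≡ 4))
    × (∃ λ v → deg T v ≡ 4 × angCount T v θ ≡ 0)
    × (∀ k → 5 ≤ k
        → (∀ v → 4 ≤ deg T v → deg T v ≤ k → angCount T v φ ≡ 0)
        → ∃ λ v → k + 1 ≤ deg T v × k / 2 + 1 ≤ angCount T v φ)
    × (∀ ψ → ψ ≢ θ → ψ ≢ φ
        → (∀ v → deg T v ≡ 4 → angCount T v ψ ≡ 4)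
        → (∃ λ v → deg T v ≡ 5 × angCount T v ψ + angCount T v θ ≤ 1)
        × (∃ λ v → deg T v ≡ 5 × angCount T v θ ≡ 0))
    × (∀ ψ → ψ ≢ θ → ψ ≢ φ
        → (∀ v → deg T v ≡ 4 → angCount T v θ + angCount T v ψ ≡ 4)
        → ∃ λ v → deg T v ≡ 5 × angCount T v θ + angCount T v ψ ≤ 1)
    × ((∀ v → deg T v ≡ 4 → 2 ≤ angCount T v φ)
        → ∃ λ v → deg T v ≡ 5 × angCount T v φ ≡ 0 × angCount T v θ ≡ 0)
    × (∀ ψ → ψ ≢ θ → ψ ≢ φ
        → (∃ λ v → deg T v ≡ 4 × 1 ≤ angCount T v ψ)
        ⊎ (∃ λ v → deg T v ≡ 5 × 3 ≤ angCount T v ψ)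
        ⊎ (∃ λ v → deg T v ≡ 6 × 5 ≤ angCount T v ψ)
        ⊎ (∃ λ v → deg T v ≡ 7 × angCount T v ψ ≡ 7))
lemma7 T θ φ θ≢φ deg≥3 θ²φ =
  v₄-formula ,
  (v₄-bound , 16≤F , map₂ proj₁ degree-4-without-θ) ,
  degree-4-without-θ ,
  φ-heavy-vertex ,
  -- Parts 5 and 6 hold without ψ ≢ θ, φ.
  (λ ψ _ _ → ψ⁴⇒degree-5-vertices ψ) ,
  (λ ψ _ _ → θψ⁴⇒degree-5-vertex ψ) ,
  degree-5-without-θφ ,
  ψ-rich-vertex
  where
  open Discharging T θ φ θ≢φ deg≥3 θ²φ
  v₄-bound : 10 + countHigh T θ ≤ vnum T 4
  v₄-bound = subst (10 + countHigh T θ ≤_) (sym v₄-formula)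
                   (+-monoˡ-≤ (countHigh T θ) (m≤m+n 10 (excess5 T)))
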